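{- Let $\Phi$ be a finite reduced crystallographic root system with simple roots $\alpha_1,\dots,\alpha_r$, $S=\{1,\dots,r\}$, Weyl group $W$. If $J=\emptyset$ (i.e. $I=S$), then $W^J=W$, and the valid plays $(i_1,\dots,i_t)$ of the modified Kostant game on $I=S$ correspond bijectively, via $(i_1,\dots,i_t)\mapsto s_{i_t}\cdots s_{i_1}$, to the reduced expressions of all elements of $W$.
   Context: $\alpha^\vee=2\alpha/(\alpha,\alpha)$, $\langle x,\alpha^\vee\rangle=2(x,\alpha)/(\alpha,\alpha)$. $\ell$ is the length function of $W$ in the generators $s_1,\dots,s_r$; $W^J=\{w\in W:\ell(ws_j)>\ell(w)\ \forall j\in J\}$. Modified Kostant game on $I\subseteq S$: configurations are integer vectors $c=(c_1,\dots,c_r)$, initially $0$; for $u\neq v$, $n_{v,u}=-\langle\alpha_u,\alpha_v^\vee\rangle$. Vertex $v$ is sad in $c$ if $c_v<\frac12(\sum_{u\neq v}n_{v,u}c_u+[v\in I])$; a move at sad $v$ replaces $c_v$ by $-c_v+\sum_{u\neq v}n_{v,u}c_u+[v\in I]$. A valid play is a sequence $(i_1,\dots,i_t)$ where each $i_\lambda$ is sad in the configuration obtained after the moves $i_1,\dots,i_{\lambda-1}$ starting from $0$. -}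

module Defs where

open import Data.Nat using (ℕ; zero; suc)
open import Data.Fin using (Fin; zero; suc; _≟_)
open import Data.Integer using (ℤ; +_; _+_; _-_; _*_; -_; _<_; _≤_)
open import Data.List using (List; []; _∷_; length)
open import Data.Bool using (Bool; true; false; if_then_else_)
open import Data.Product using (Σ; ∃; _×_; _,_)
open import Relation.Binary.PropositionalEquality using (_≡_; _≢_)
open import Relation.Nullary using (yes; no; ¬_)
import Data.Nat as ℕ
open import Data.Unit using (⊤)

sumFin : ∀ {n} → (Fin n → ℤ) → ℤ
sumFin {zero}  f = + 0
sumFin {suc n} f = f zero + sumFin (λ i → f (suc i))

-- A finite reduced crystallographic root system of rank r, given through
-- its base α₁,…,α_r.  The inner product on V = span(α_i) is recorded by
-- the Gram matrix  gram i j = (α_i , α_j)  (scaled to be integral, which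
-- is possible for every crystallographic root system and does not change
-- any Cartan integer), and  cartan i j = ⟨α_i , α_j^∨⟩ = 2(α_i,α_j)/(α_j,α_j).

record RootSystem (r : ℕ) : Set where
  field
    gram       : Fin r → Fin r → ℤ
    cartan     : Fin r → Fin r → ℤ
    gram-sym   : ∀ i j → gram i j ≡ gram j i
    gram-posdef : (x : Fin r → ℤ) → (∃ λ i → x i ≢ + 0) →
                  + 0 < sumFin (λ i → sumFin (λ j → x i * gram i j * x j))
    -- ⟨α_i , α_j^∨⟩ (α_j,α_j) = 2 (α_i,α_j); crystallographic: cartan is integral
    cartan-def : ∀ i j → cartan i j * gram j j ≡ + 2 * gram i j
    gram-nonpos : ∀ i j → i ≢ j → gram i j ≤ + 0

module _ {r : ℕ} (Φ : RootSystem r) where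
  open RootSystem Φ

  -- Weyl group: elements are represented by words in the simple
  -- reflections, acting on the root lattice ℤ^r (coordinates w.r.t. the
  -- simple roots).  s_i(x) = x - ⟨x, α_i^∨⟩ α_i.

  Vector : Set
  Vector = Fin r → ℤ

  pairCo : Vector → Fin r → ℤ
  pairCo x i = sumFin (λ j → x j * cartan j i)

  reflect : Fin r → Vector → Vector
  reflect i x k with k ≟ i
  ... | yes _ = x k - pairCo x i
  ... | no  _ = x k

  -- the word (w₁,…,w_k) denotes s_{w₁} ⋯ s_{w_k}
  act : List (Fin r) → Vector → Vector
  act []      x = x
  act (i ∷ w) x = reflect i (act w x)

  -- two words denote the same element of W (W acts faithfully on V)
  _∼W_ : List (Fin r) → List (Fin r) → Set
  w ∼W w' = ∀ x k → act w x k ≡ act w' x k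

  Reduced : List (Fin r) → Set
  Reduced w = ∀ w' → w ∼W w' → length w ℕ.≤ length w'

  Config : Set
  Config = Fin r → ℤ

  indicator : Bool → ℤ
  indicator true  = + 1
  indicator false = + 0

  nvu : Fin r → Fin r → ℤ
  nvu v u = - cartan u v

  neighbourSum : (Fin r → Bool) → Config → Fin r → ℤ
  neighbourSum I c v =
    sumFin (λ u → if isYes (u ≟ v) then + 0 else nvu v u * c u) + indicator (I v)
    where
      isYes : ∀ {P : Set} → Relation.Nullary.Dec P → Bool
      isYes (yes _) = true
      isYes (no _)  = false

  -- v sad:  c_v < ½(…)  ⇔  2 c_v < …
  Sad : (Fin r → Bool) → Config → Fin r → Set
  Sad I c v = + 2 * c v < neighbourSum I c v

  move : (Fin r → Bool) → Config → Fin r → Config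
  move I c v u with u ≟ v
  ... | yes _ = - c v + neighbourSum I c v
  ... | no  _ = c u

  ValidFrom : (Fin r → Bool) → Config → List (Fin r) → Set
  ValidFrom I c []       = ⊤
  ValidFrom I c (i ∷ is) = Sad I c i × ValidFrom I (move I c i) is

  ValidPlay : (Fin r → Bool) → List (Fin r) → Set
  ValidPlay I = ValidFrom I (λ _ → + 0)

{-# OPTIONS --safe #-}
-- Let ρ be the weight with ⟨ρ, α_v^∨⟩ = 1 for every v.  A move at i changes the configuration c
-- exactly so that ρ − c is replaced by s_i (ρ − c); hence after the play i₁ ⋯ i_t we have
-- ρ − c = s_{i_t} ⋯ s_{i_1} ρ, and v is sad iff (ρ, s_{i_1} ⋯ s_{i_t} α_v) > 0, i.e. iff the root
-- w α_v is positive for w = s_{i_1} ⋯ s_{i_t}.  For reduced w, the word w s_v is reduced iff w α_v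
-- is positive, so by induction on t the valid plays are exactly the reduced words; reversing a
-- word preserves reducedness.
--
-- The positivity criterion is proved as for Coxeter groups (Humphreys, §5.4): if w ends
-- in t ≠ s, write w = v z with z a word in s, t and v as short as possible.  Induction gives
-- v α_s, v α_t ≥ 0, while z is a reduced alternating word that stays reduced after s, so z α_s is a
-- nonnegative combination of α_s and α_t.  The latter is checked by computation, since positive
-- definiteness leaves only the Cartan pairs of types A₁ × A₁, A₂, B₂ and G₂.

module Submission where

open import Defs

open import Algebra.Properties.Semiring.Sum as Sum using ()
open import Data.Bool using (Bool; true; false; not; if_then_else_)
open import Data.Bool.Properties using (¬-not) renaming (_≟_ to _≟ᴮ_)
open import Data.Empty using (⊥; ⊥-elim)
open import Data.Fin using (Fin; zero; suc; _≟_)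
open import Data.Fin.Properties using (all?)
open import Data.Integer
  using (ℤ; +_; -[1+_]; +[1+_]; _+_; _-_; _*_; -_; _<_; _≤_; _≤?_; +≤+; +<+
        ; Positive; NonZero; NonNegative; positive; nonNegative; >-nonZero)
import Data.Integer.Properties as ℤP
open import Data.Integer.Tactic.RingSolver using (solve-∀)
open import Data.List using (List; []; _∷_; _++_; _∷ʳ_; [_]; length; map; reverse; initLast; _∷ʳ′_)
import Data.List.Properties as ListP
open import Data.Nat using (ℕ; zero; suc; z≤n; s≤s)
import Data.Nat as ℕ
import Data.Nat.Induction as ℕI
import Data.Nat.Properties as ℕP
open ℕP using (allUpTo?)
open import Data.Product using (Σ; ∃; ∃₂; _×_; _,_; proj₁; proj₂)
open import Data.Unit using (tt)
open import Function using (_∘_; _on_; _⇔_; mk⇔; Equivalence)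
import Function.Properties.Equivalence as ⇔
open import Induction.WellFounded using (Acc; acc)
open import Level using (0ℓ)
open import Relation.Binary using (Setoid)
import Relation.Binary.Construct.On as On
open import Relation.Binary.PropositionalEquality hiding ([_])
import Relation.Binary.Reasoning.Setoid as SetoidReasoning
open import Relation.Nullary using (¬_; yes; no; Dec)
open import Relation.Nullary.Decidable using (decidable-stable; True; toWitness; _×-dec_)

open Sum ℤP.+-*-semiring using (sum; sum-cong-≗; ∑-distrib-+; *-distribˡ-sum; sum-replicate-zero)

sumFin≡sum : ∀ {n} (f : Fin n → ℤ) → sumFin f ≡ sum f
sumFin≡sum {zero}  f = refl
sumFin≡sum {suc n} f = cong (_+_ (f zero)) (sumFin≡sum (f ∘ suc))

sumFin-cong : ∀ {n} {f g : Fin n → ℤ} → f ≗ g → sumFin f ≡ sumFin g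
sumFin-cong {f = f} {g} f≗g =
  trans (sumFin≡sum f) (trans (sum-cong-≗ f≗g) (sym (sumFin≡sum g)))

sumFin-zero : ∀ n → sumFin {n} (λ _ → + 0) ≡ + 0
sumFin-zero n = trans (sumFin≡sum {n} (λ _ → + 0)) (sum-replicate-zero n)

sumFin-+ : ∀ {n} (f g : Fin n → ℤ) → sumFin (λ i → f i + g i) ≡ sumFin f + sumFin g
sumFin-+ f g = trans (sumFin≡sum (λ i → f i + g i))
  (trans (∑-distrib-+ f g) (sym (cong₂ _+_ (sumFin≡sum f) (sumFin≡sum g))))

*-distribˡ-sumFin : ∀ {n} c (f : Fin n → ℤ) → c * sumFin f ≡ sumFin (λ i → c * f i)
*-distribˡ-sumFin c f = trans (cong (_*_ c) (sumFin≡sum f))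
  (trans (*-distribˡ-sum c f) (sym (sumFin≡sum (λ i → c * f i))))

neg-distrib-sumFin : ∀ {n} (f : Fin n → ℤ) → - sumFin f ≡ sumFin (λ i → - f i)
neg-distrib-sumFin f = trans (sym (ℤP.-1*i≡-i _))
  (trans (*-distribˡ-sumFin (-[1+ 0 ]) f) (sumFin-cong (ℤP.-1*i≡-i ∘ f)))

sumFin-linear : ∀ {n} A B (f g : Fin n → ℤ) →
  sumFin (λ i → A * f i + B * g i) ≡ A * sumFin f + B * sumFin g
sumFin-linear A B f g = trans (sumFin-+ (λ i → A * f i) (λ i → B * g i))
  (sym (cong₂ _+_ (*-distribˡ-sumFin A f) (*-distribˡ-sumFin B g)))

sumFin-nonneg : ∀ {n} (f : Fin n → ℤ) → (∀ i → + 0 ≤ f i) → + 0 ≤ sumFin f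
sumFin-nonneg {zero}  f f≥0 = +≤+ z≤n
sumFin-nonneg {suc n} f f≥0 = ℤP.+-mono-≤ (f≥0 zero) (sumFin-nonneg (f ∘ suc) (f≥0 ∘ suc))

sumFin-nonpos : ∀ {n} (f : Fin n → ℤ) → (∀ i → f i ≤ + 0) → sumFin f ≤ + 0
sumFin-nonpos {zero}  f f≤0 = +≤+ z≤n
sumFin-nonpos {suc n} f f≤0 = ℤP.+-mono-≤ (f≤0 zero) (sumFin-nonpos (f ∘ suc) (f≤0 ∘ suc))

sumFin-pos : ∀ {n} (f : Fin n → ℤ) → (∀ i → + 0 ≤ f i) → ∀ j → + 0 < f j → + 0 < sumFin f
sumFin-pos f f≥0 zero    fj>0 = ℤP.+-mono-<-≤ fj>0 (sumFin-nonneg (f ∘ suc) (f≥0 ∘ suc))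
sumFin-pos f f≥0 (suc j) fj>0 = ℤP.+-mono-≤-< (f≥0 zero) (sumFin-pos (f ∘ suc) (f≥0 ∘ suc) j fj>0)

*-nonneg : ∀ {i j} → + 0 ≤ i → + 0 ≤ j → + 0 ≤ i * j
*-nonneg {i} i≥0 j≥0 =
  subst (_≤ i * _) (ℤP.*-zeroʳ i) (ℤP.*-monoˡ-≤-nonNeg i {{nonNegative i≥0}} j≥0)

δ : ∀ {n} → Fin n → Fin n → ℤ
δ zero    zero    = + 1
δ zero    (suc _) = + 0
δ (suc _) zero    = + 0
δ (suc i) (suc k) = δ i k

δ-diag : ∀ {n} (i : Fin n) → δ i i ≡ + 1
δ-diag zero    = refl
δ-diag (suc i) = δ-diag i

δ-offdiag : ∀ {n} (i k : Fin n) → k ≢ i → δ i k ≡ + 0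
δ-offdiag zero    zero    k≢i = ⊥-elim (k≢i refl)
δ-offdiag zero    (suc k) k≢i = refl
δ-offdiag (suc i) zero    k≢i = refl
δ-offdiag (suc i) (suc k) k≢i = δ-offdiag i k (k≢i ∘ cong suc)

δ-nonneg : ∀ {n} (i k : Fin n) → + 0 ≤ δ i k
δ-nonneg zero    zero    = +≤+ z≤n
δ-nonneg zero    (suc k) = +≤+ z≤n
δ-nonneg (suc i) zero    = +≤+ z≤n
δ-nonneg (suc i) (suc k) = δ-nonneg i k

sumFin-δ : ∀ {n} (i : Fin n) (f : Fin n → ℤ) → sumFin (λ k → δ i k * f k) ≡ f i
sumFin-δ {suc n} zero    f = trans (cong₂ _+_ (ℤP.*-identityˡ (f zero))
  (trans (sumFin-cong (ℤP.*-zeroˡ ∘ f ∘ suc)) (sumFin-zero n))) (ℤP.+-identityʳ (f zero))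
sumFin-δ {suc n} (suc i) f = trans (cong (_+ sumFin (λ k → δ i k * f (suc k))) (ℤP.*-zeroˡ (f zero)))
  (trans (ℤP.+-identityˡ _) (sumFin-δ i (f ∘ suc)))

¬¬-minimum : {A : Set} (μ : A → ℕ) → A → ¬ ¬ (Σ A λ a → ∀ b → μ a ℕ.≤ μ b)
¬¬-minimum μ a noMinimum = below (suc (μ a)) a ℕP.≤-refl
  where
  below : ∀ n b → μ b ℕ.< n → ⊥
  below (suc n) b (s≤s μb≤n) = noMinimum (b , λ c →
    ℕP.≮⇒≥ (λ μc<μb → below n c (ℕP.<-≤-trans μc<μb μb≤n)))

length-∷ʳ : {A : Set} (xs : List A) (x : A) → length (xs ∷ʳ x) ≡ suc (length xs)
length-∷ʳ xs x = trans (ListP.length-++ xs) (ℕP.+-comm (length xs) 1)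

-- Let a = ⟨α_s, α_t^∨⟩ and b = ⟨α_t, α_s^∨⟩.  A word in s and t sends x to
-- y = x + cₛ α_s + cₜ α_t; a PlaneState records cₛ, cₜ, ⟨y, α_s^∨⟩ and ⟨y, α_t^∨⟩ as linear forms
-- (coefficient pairs) in p₀ = ⟨x, α_s^∨⟩ and q₀ = ⟨x, α_t^∨⟩, so that for numerals a and b the
-- braid relation and the positivity of the roots reduce to evaluation.

Form : Set
Form = ℤ × ℤ

⟦_⟧ : Form → ℤ → ℤ → ℤ
⟦ (λₚ , λq) ⟧ p₀ q₀ = λₚ * p₀ + λq * q₀

_-ᶠ_ : Form → Form → Form
(λₚ , λq) -ᶠ (μₚ , μq) = λₚ - μₚ , λq - μq

-ᶠ_ : Form → Form
-ᶠ (λₚ , λq) = - λₚ , - λq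

_*ᶠ_ : Form → ℤ → Form
(λₚ , λq) *ᶠ c = λₚ * c , λq * c

⟦⟧-sub : ∀ f g {p₀ q₀} → ⟦ f -ᶠ g ⟧ p₀ q₀ ≡ ⟦ f ⟧ p₀ q₀ - ⟦ g ⟧ p₀ q₀
⟦⟧-sub (λₚ , λq) (μₚ , μq) = distrib λₚ λq μₚ μq _ _
  where
  distrib : ∀ λₚ λq μₚ μq p q → (λₚ - μₚ) * p + (λq - μq) * q ≡ λₚ * p + λq * q - (μₚ * p + μq * q)
  distrib = solve-∀

⟦⟧-neg : ∀ f {p₀ q₀} → ⟦ -ᶠ f ⟧ p₀ q₀ ≡ - ⟦ f ⟧ p₀ q₀
⟦⟧-neg (λₚ , λq) = distrib λₚ λq _ _
  where
  distrib : ∀ λₚ λq p q → - λₚ * p + - λq * q ≡ - (λₚ * p + λq * q)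
  distrib = solve-∀

⟦⟧-scale : ∀ f c {p₀ q₀} → ⟦ f *ᶠ c ⟧ p₀ q₀ ≡ ⟦ f ⟧ p₀ q₀ * c
⟦⟧-scale (λₚ , λq) c = distrib λₚ λq c _ _
  where
  distrib : ∀ λₚ λq c p q → λₚ * c * p + λq * c * q ≡ (λₚ * p + λq * q) * c
  distrib = solve-∀

alternatingHead : ℕ → Bool
alternatingHead zero    = false
alternatingHead (suc k) = not (alternatingHead k)

-- alternating k = ⋯ s t, the alternating word of length k ending in t (false).
alternating : ℕ → List Bool
alternating zero    = []
alternating (suc k) = alternatingHead k ∷ alternating k

length-alternating : ∀ k → length (alternating k) ≡ k
length-alternating zero    = refl
length-alternating (suc k) = cong suc (length-alternating k)

alternating-split : ∀ j m → Σ (List Bool) λ P → length P ≡ j × alternating (j ℕ.+ m) ≡ P ++ alternating m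
alternating-split zero    m = [] , refl , refl
alternating-split (suc j) m with alternating-split j m
... | P , P-length , split =
  alternatingHead (j ℕ.+ m) ∷ P , cong suc P-length , cong (alternatingHead (j ℕ.+ m) ∷_) split

record PlaneState : Set where
  constructor ⟨_,_,_,_⟩
  field coeffₛ coeffₜ pairₛ pairₜ : Form
open PlaneState

start : PlaneState
start = ⟨ (+ 0 , + 0) , (+ 0 , + 0) , (+ 1 , + 0) , (+ 0 , + 1) ⟩

coefficients : PlaneState → Form × Form
coefficients σ = coeffₛ σ , coeffₜ σ

module Rank2 (a b : ℤ) where

  step : Bool → PlaneState → PlaneState
  step true  ⟨ cₛ , cₜ , pₛ , pₜ ⟩ = ⟨ cₛ -ᶠ pₛ , cₜ , -ᶠ pₛ , pₜ -ᶠ (pₛ *ᶠ a) ⟩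
  step false ⟨ cₛ , cₜ , pₛ , pₜ ⟩ = ⟨ cₛ , cₜ -ᶠ pₜ , pₛ -ᶠ (pₜ *ᶠ b) , -ᶠ pₜ ⟩

  run : List Bool → PlaneState
  run []      = start
  run (ℓ ∷ z) = step ℓ (run z)

  -- (alternating k) α_s = (1 + cₛ) α_s + cₜ α_t, the forms evaluated at the pairings (2, a) of α_s.
  AlternatingPositive : ℕ → Set
  AlternatingPositive k =
    + 0 ≤ + 1 + ⟦ coeffₛ (run (alternating k)) ⟧ (+ 2) a × + 0 ≤ ⟦ coeffₜ (run (alternating k)) ⟧ (+ 2) a

  alternatingPositive? : ∀ k → Dec (AlternatingPositive k)
  alternatingPositive? k = (+ 0 ≤? _) ×-dec (+ 0 ≤? _)

  record DihedralData : Set where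
    field
      order                : ℕ
      braid-rhs            : List Bool
      braid                : coefficients (run (alternating order ∷ʳ true))
                             ≡ coefficients (run braid-rhs)
      braid-rhs-length     : suc (length braid-rhs) ≡ order
      alternating-positive : ∀ {k} → k ℕ.< order → AlternatingPositive k

  mkDihedralData : ∀ m R → coefficients (run (alternating m ∷ʳ true)) ≡ coefficients (run R) →
    suc (length R) ≡ m → {True (allUpTo? alternatingPositive? m)} → DihedralData
  mkDihedralData m R braid R-length {positive} = record
    { order = m ; braid-rhs = R ; braid = braid ; braid-rhs-length = R-length
    ; alternating-positive = toWitness positive }

classify : ∀ a b → a ≤ + 0 → b ≤ + 0 → (a ≡ + 0 → b ≡ + 0) → (b ≡ + 0 → a ≡ + 0) → a * b < + 4 →
  Rank2.DihedralData a b
classify +[1+ _ ] _        (+≤+ ()) _ _ _ _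
classify _        +[1+ _ ] _ (+≤+ ()) _ _ _
classify (+ 0)    b        _ _ a≡0⇒b≡0 _ _ with a≡0⇒b≡0 refl
... | refl = Rank2.mkDihedralData (+ 0) (+ 0) 2 (false ∷ []) refl refl
classify -[1+ _ ] (+ 0)    _ _ _ b≡0⇒a≡0 _ with b≡0⇒a≡0 refl
... | ()
classify -[1+ 0 ] -[1+ 0 ] _ _ _ _ _ =
  Rank2.mkDihedralData _ _ 3 (true ∷ false ∷ []) refl refl
classify -[1+ 0 ] -[1+ 1 ] _ _ _ _ _ =
  Rank2.mkDihedralData _ _ 4 (false ∷ true ∷ false ∷ []) refl refl
classify -[1+ 1 ] -[1+ 0 ] _ _ _ _ _ =
  Rank2.mkDihedralData _ _ 4 (false ∷ true ∷ false ∷ []) refl refl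
classify -[1+ 0 ] -[1+ 2 ] _ _ _ _ _ =
  Rank2.mkDihedralData _ _ 6 (false ∷ true ∷ false ∷ true ∷ false ∷ []) refl refl
classify -[1+ 2 ] -[1+ 0 ] _ _ _ _ _ =
  Rank2.mkDihedralData _ _ 6 (false ∷ true ∷ false ∷ true ∷ false ∷ []) refl refl
classify -[1+ 0 ]                  -[1+ suc (suc (suc _)) ]  _ _ _ _ (+<+ (s≤s (s≤s (s≤s (s≤s ())))))
classify -[1+ 1 ]                  -[1+ 1 ]                  _ _ _ _ (+<+ (s≤s (s≤s (s≤s (s≤s ())))))
classify -[1+ 1 ]                  -[1+ 2 ]                  _ _ _ _ (+<+ (s≤s (s≤s (s≤s (s≤s ())))))
classify -[1+ 1 ]                  -[1+ suc (suc (suc _)) ]  _ _ _ _ (+<+ (s≤s (s≤s (s≤s (s≤s ())))))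
classify -[1+ 2 ]                  -[1+ 1 ]                  _ _ _ _ (+<+ (s≤s (s≤s (s≤s (s≤s ())))))
classify -[1+ 2 ]                  -[1+ 2 ]                  _ _ _ _ (+<+ (s≤s (s≤s (s≤s (s≤s ())))))
classify -[1+ 2 ]                  -[1+ suc (suc (suc _)) ]  _ _ _ _ (+<+ (s≤s (s≤s (s≤s (s≤s ())))))
classify -[1+ suc (suc (suc _)) ]  -[1+ 0 ]                  _ _ _ _ (+<+ (s≤s (s≤s (s≤s (s≤s ())))))
classify -[1+ suc (suc (suc _)) ]  -[1+ 1 ]                  _ _ _ _ (+<+ (s≤s (s≤s (s≤s (s≤s ())))))
classify -[1+ suc (suc (suc _)) ]  -[1+ 2 ]                  _ _ _ _ (+<+ (s≤s (s≤s (s≤s (s≤s ())))))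
classify -[1+ suc (suc (suc _)) ]  -[1+ suc (suc (suc _)) ]  _ _ _ _ (+<+ (s≤s (s≤s (s≤s (s≤s ())))))

module _ {r : ℕ} (Φ : RootSystem r) where
  open RootSystem Φ

  Word : Set
  Word = List (Fin r)

  V : Set
  V = Vector Φ

  α : Fin r → V
  α = δ

  NonNeg NonPos : V → Set
  NonNeg y = ∀ k → + 0 ≤ y k
  NonPos y = ∀ k → y k ≤ + 0

  nonneg? : ∀ y → Dec (NonNeg y)
  nonneg? y = all? (λ k → + 0 ≤? y k)

  nonpos? : ∀ y → Dec (NonPos y)
  nonpos? y = all? (λ k → y k ≤? + 0)

  sumFin-combination : ∀ (F : Fin r → ℤ) u v i j →
    sumFin (λ k → F k * (u * α i k + v * α j k)) ≡ u * F i + v * F j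
  sumFin-combination F u v i j = begin
    sumFin (λ k → F k * (u * α i k + v * α j k))
      ≡⟨ sumFin-cong (λ k → distrib (F k) u v (α i k) (α j k)) ⟩
    sumFin (λ k → u * (α i k * F k) + v * (α j k * F k))
      ≡⟨ sumFin-linear u v (λ k → α i k * F k) (λ k → α j k * F k) ⟩
    u * sumFin (λ k → α i k * F k) + v * sumFin (λ k → α j k * F k)
      ≡⟨ cong₂ (λ x y → u * x + v * y) (sumFin-δ i F) (sumFin-δ j F) ⟩
    u * F i + v * F j ∎
    where
    open ≡-Reasoning
    distrib : ∀ f u v a b → f * (u * a + v * b) ≡ u * (a * f) + v * (b * f)
    distrib = solve-∀

  gram-diag-pos : ∀ i → + 0 < gram i i
  gram-diag-pos i = subst (+ 0 <_) norm-α (gram-posdef (α i) (i , α-nonzero))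
    where
    α-nonzero : α i i ≢ + 0
    α-nonzero eq with trans (sym (δ-diag i)) eq
    ... | ()
    norm-α : sumFin (λ a → sumFin (λ b → α i a * gram a b * α i b)) ≡ gram i i
    norm-α = trans
      (sumFin-cong λ a → trans (sumFin-cong λ b → ℤP.*-comm (α i a * gram a b) (α i b)) (sumFin-δ i _))
      (sumFin-δ i (λ a → gram a i))

  private instance
    gram-diag-positive : ∀ {i} → Positive (gram i i)
    gram-diag-positive {i} = positive (gram-diag-pos i)
    gram-diag-nonZero : ∀ {i} → NonZero (gram i i)
    gram-diag-nonZero {i} = >-nonZero (gram-diag-pos i)
    gram-diag-nonNegative : ∀ {i} → NonNegative (gram i i)
    gram-diag-nonNegative {i} = nonNegative (ℤP.<⇒≤ (gram-diag-pos i))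

  cartan-diag : ∀ i → cartan i i ≡ + 2
  cartan-diag i = ℤP.*-cancelʳ-≡ (cartan i i) (+ 2) (gram i i) (cartan-def i i)

  cartan-offdiag-nonpos : ∀ i j → i ≢ j → cartan i j ≤ + 0
  cartan-offdiag-nonpos i j i≢j = ℤP.*-cancelʳ-≤-pos (cartan i j) (+ 0) (gram j j) (begin
    cartan i j * gram j j ≡⟨ cartan-def i j ⟩
    + 2 * gram i j        ≤⟨ ℤP.*-monoˡ-≤-nonNeg (+ 2) (gram-nonpos i j i≢j) ⟩
    + 0                   ∎)
    where open ℤP.≤-Reasoning

  cartan-symmetrised : ∀ i j → cartan i j * gram j j ≡ cartan j i * gram i i
  cartan-symmetrised i j =
    trans (cartan-def i j) (trans (cong (+ 2 *_) (gram-sym i j)) (sym (cartan-def j i)))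

  cartan-zero-sym : ∀ i j → cartan i j ≡ + 0 → cartan j i ≡ + 0
  cartan-zero-sym i j aij≡0 = ℤP.*-cancelʳ-≡ (cartan j i) (+ 0) (gram i i)
    (trans (sym (cartan-symmetrised i j)) (cong (_* gram j j) aij≡0))

  norm : V → ℤ
  norm x = sumFin (λ k → sumFin (λ l → x k * gram k l * x l))

  norm-combination : ∀ u i v j → norm (λ k → u * α i k + v * α j k)
                                 ≡ u * (u * gram i i + v * gram i j) + v * (u * gram j i + v * gram j j)
  norm-combination u i v j = begin
    norm x
      ≡⟨ sumFin-cong (λ k → sumFin-combination (λ l → x k * gram k l) u v i j) ⟩
    sumFin (λ k → u * (x k * gram k i) + v * (x k * gram k j))
      ≡⟨ sumFin-cong (λ k → regroup u v (x k) (gram k i) (gram k j)) ⟩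
    sumFin (λ k → (u * gram k i + v * gram k j) * x k)
      ≡⟨ sumFin-combination (λ k → u * gram k i + v * gram k j) u v i j ⟩
    u * (u * gram i i + v * gram i j) + v * (u * gram j i + v * gram j j) ∎
    where
    open ≡-Reasoning
    x : V
    x k = u * α i k + v * α j k
    regroup : ∀ u v x g h → u * (x * g) + v * (x * h) ≡ (u * g + v * h) * x
    regroup = solve-∀

  norm-cartan-combination : ∀ i j →
    norm (λ k → - cartan j i * α i k + + 2 * α j k) ≡ gram j j * (+ 4 - cartan i j * cartan j i)
  norm-cartan-combination i j = begin
    norm (λ k → - b * α i k + + 2 * α j k)
      ≡⟨ norm-combination (- b) i (+ 2) j ⟩
    - b * (- b * gram i i + + 2 * gram i j) + + 2 * (- b * gram j i + + 2 * gram j j)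
      ≡⟨ cong (λ g → - b * (- b * gram i i + + 2 * gram i j) + + 2 * (- b * g + + 2 * gram j j))
              (gram-sym j i) ⟩
    - b * (- b * gram i i + + 2 * gram i j) + + 2 * (- b * gram i j + + 2 * gram j j)
      ≡⟨ expand b (gram i i) (gram i j) (gram j j) ⟩
    b * (b * gram i i) - + 4 * b * gram i j + + 4 * gram j j
      ≡⟨ cong (λ g → b * g - + 4 * b * gram i j + + 4 * gram j j)
              (trans (cartan-def j i) (cong (+ 2 *_) (gram-sym j i))) ⟩
    b * (+ 2 * gram i j) - + 4 * b * gram i j + + 4 * gram j j
      ≡⟨ collect b (gram i j) (gram j j) ⟩
    + 4 * gram j j - b * (+ 2 * gram i j)
      ≡⟨ cong (λ g → + 4 * gram j j - b * g) (sym (cartan-def i j)) ⟩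
    + 4 * gram j j - b * (a * gram j j)
      ≡⟨ factor a b (gram j j) ⟩
    gram j j * (+ 4 - a * b) ∎
    where
    open ≡-Reasoning
    a b : ℤ
    a = cartan i j
    b = cartan j i
    expand : ∀ b gii gij gjj → - b * (- b * gii + + 2 * gij) + + 2 * (- b * gij + + 2 * gjj)
                               ≡ b * (b * gii) - + 4 * b * gij + + 4 * gjj
    expand = solve-∀
    collect : ∀ b gij gjj → b * (+ 2 * gij) - + 4 * b * gij + + 4 * gjj ≡ + 4 * gjj - b * (+ 2 * gij)
    collect = solve-∀
    factor : ∀ a b gjj → + 4 * gjj - b * (a * gjj) ≡ gjj * (+ 4 - a * b)
    factor = solve-∀

  cartan-product<4 : ∀ i j → i ≢ j → cartan i j * cartan j i < + 4
  cartan-product<4 i j i≢j = ℤP.≰⇒> λ 4≤ab →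
    ℤP.<⇒≱ (subst (+ 0 <_) (norm-cartan-combination i j) (gram-posdef x (j , x-nonzero))) (begin
      gram j j * (+ 4 - cartan i j * cartan j i) ≤⟨ ℤP.*-monoˡ-≤-nonNeg (gram j j) (ℤP.i≤j⇒i-j≤0 4≤ab) ⟩
      gram j j * + 0                             ≡⟨ ℤP.*-zeroʳ (gram j j) ⟩
      + 0                                        ∎)
    where
    open ℤP.≤-Reasoning
    x : V
    x k = - cartan j i * α i k + + 2 * α j k
    x-at-j : x j ≡ + 2
    x-at-j = trans (cong₂ (λ p q → - cartan j i * p + + 2 * q) (δ-offdiag i j (i≢j ∘ sym)) (δ-diag j))
                   (evaluate (cartan j i))
      where
      evaluate : ∀ b → - b * + 0 + + 2 * + 1 ≡ + 2
      evaluate = solve-∀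
    x-nonzero : x j ≢ + 0
    x-nonzero eq with trans (sym x-at-j) eq
    ... | ()

  pairCo-cong : ∀ {x y} → x ≗ y → ∀ i → pairCo Φ x i ≡ pairCo Φ y i
  pairCo-cong x≗y i = sumFin-cong (λ j → cong (_* cartan j i) (x≗y j))

  pairCo-α : ∀ i j → pairCo Φ (α i) j ≡ cartan i j
  pairCo-α i j = sumFin-δ i (λ k → cartan k j)

  pairCo-linear : ∀ A B x y i →
    pairCo Φ (λ k → A * x k + B * y k) i ≡ A * pairCo Φ x i + B * pairCo Φ y i
  pairCo-linear A B x y i =
    trans (sumFin-cong (λ j → distrib A B (x j) (y j) (cartan j i)))
          (sumFin-linear A B (λ j → x j * cartan j i) (λ j → y j * cartan j i))
    where
    distrib : ∀ A B a b c → (A * a + B * b) * c ≡ A * (a * c) + B * (b * c)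
    distrib = solve-∀

  reflect-formula : ∀ i x k → reflect Φ i x k ≡ x k - α i k * pairCo Φ x i
  reflect-formula i x k with k ≟ i
  ... | yes refl = cong (_-_ (x k)) (sym (trans (cong (_* pairCo Φ x k) (δ-diag k)) (ℤP.*-identityˡ _)))
  ... | no k≢i =
    sym (trans (cong (λ d → x k - d * pairCo Φ x i) (δ-offdiag i k k≢i)) (ℤP.+-identityʳ (x k)))

  reflect-combination : ∀ i x → reflect Φ i x ≗ (λ k → + 1 * x k + (- pairCo Φ x i) * α i k)
  reflect-combination i x k = trans (reflect-formula i x k) (rearrange (x k) (α i k) (pairCo Φ x i))
    where
    rearrange : ∀ a d p → a - d * p ≡ + 1 * a + (- p) * d
    rearrange = solve-∀

  pairCo-reflect : ∀ i y j → pairCo Φ (reflect Φ i y) j ≡ pairCo Φ y j - pairCo Φ y i * cartan i j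
  pairCo-reflect i y j = begin
    pairCo Φ (reflect Φ i y) j
      ≡⟨ pairCo-cong (reflect-combination i y) j ⟩
    pairCo Φ (λ k → + 1 * y k + (- p) * α i k) j
      ≡⟨ pairCo-linear (+ 1) (- p) y (α i) j ⟩
    + 1 * pairCo Φ y j + (- p) * pairCo Φ (α i) j
      ≡⟨ cong (λ c → + 1 * pairCo Φ y j + (- p) * c) (pairCo-α i j) ⟩
    + 1 * pairCo Φ y j + (- p) * cartan i j
      ≡⟨ rearrange (pairCo Φ y j) p (cartan i j) ⟩
    pairCo Φ y j - p * cartan i j ∎
    where
    open ≡-Reasoning
    p : ℤ
    p = pairCo Φ y i
    rearrange : ∀ q p c → + 1 * q + (- p) * c ≡ q - p * c
    rearrange = solve-∀

  reflect-cong : ∀ i {x y} → x ≗ y → reflect Φ i x ≗ reflect Φ i y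
  reflect-cong i {x} {y} x≗y k = begin
    reflect Φ i x k                ≡⟨ reflect-formula i x k ⟩
    x k - α i k * pairCo Φ x i     ≡⟨ cong₂ (λ a p → a - α i k * p) (x≗y k) (pairCo-cong x≗y i) ⟩
    y k - α i k * pairCo Φ y i     ≡⟨ reflect-formula i y k ⟨
    reflect Φ i y k                ∎
    where open ≡-Reasoning

  reflect-linear : ∀ i A B x y →
    reflect Φ i (λ k → A * x k + B * y k) ≗ (λ k → A * reflect Φ i x k + B * reflect Φ i y k)
  reflect-linear i A B x y k = begin
    reflect Φ i (λ k → A * x k + B * y k) k
      ≡⟨ reflect-formula i _ k ⟩
    A * x k + B * y k - α i k * pairCo Φ (λ k → A * x k + B * y k) i
      ≡⟨ cong (λ p → A * x k + B * y k - α i k * p) (pairCo-linear A B x y i) ⟩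
    A * x k + B * y k - α i k * (A * pairCo Φ x i + B * pairCo Φ y i)
      ≡⟨ distrib A B (x k) (y k) (α i k) (pairCo Φ x i) (pairCo Φ y i) ⟩
    A * (x k - α i k * pairCo Φ x i) + B * (y k - α i k * pairCo Φ y i)
      ≡⟨ cong₂ (λ a b → A * a + B * b) (reflect-formula i x k) (reflect-formula i y k) ⟨
    A * reflect Φ i x k + B * reflect Φ i y k ∎
    where
    open ≡-Reasoning
    distrib : ∀ A B a b d p q → A * a + B * b - d * (A * p + B * q) ≡ A * (a - d * p) + B * (b - d * q)
    distrib = solve-∀

  reflect-involutive : ∀ i x → reflect Φ i (reflect Φ i x) ≗ x
  reflect-involutive i x k = begin
    reflect Φ i (reflect Φ i x) k
      ≡⟨ reflect-formula i _ k ⟩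
    reflect Φ i x k - α i k * pairCo Φ (reflect Φ i x) i
      ≡⟨ cong₂ (λ a q → a - α i k * q) (reflect-formula i x k)
               (trans (pairCo-reflect i x i) (cong (λ c → p - p * c) (cartan-diag i))) ⟩
    x k - α i k * p - α i k * (p - p * + 2)
      ≡⟨ cancel (x k) (α i k) p ⟩
    x k ∎
    where
    open ≡-Reasoning
    p : ℤ
    p = pairCo Φ x i
    cancel : ∀ a d p → a - d * p - d * (p - p * + 2) ≡ a
    cancel = solve-∀

  reflect-α-self : ∀ i → reflect Φ i (α i) ≗ (λ k → - α i k)
  reflect-α-self i k = begin
    reflect Φ i (α i) k                    ≡⟨ reflect-formula i (α i) k ⟩
    α i k - α i k * pairCo Φ (α i) i
      ≡⟨ cong (λ c → α i k - α i k * c) (trans (pairCo-α i i) (cartan-diag i)) ⟩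
    α i k - α i k * + 2                    ≡⟨ negate (α i k) ⟩
    - α i k                                ∎
    where
    open ≡-Reasoning
    negate : ∀ a → a - a * + 2 ≡ - a
    negate = solve-∀

  act-cong : ∀ w {x y} → x ≗ y → act Φ w x ≗ act Φ w y
  act-cong []      x≗y = x≗y
  act-cong (i ∷ w) x≗y = reflect-cong i (act-cong w x≗y)

  act-linear : ∀ w A B x y →
    act Φ w (λ k → A * x k + B * y k) ≗ (λ k → A * act Φ w x k + B * act Φ w y k)
  act-linear []      A B x y k = refl
  act-linear (i ∷ w) A B x y k =
    trans (reflect-cong i (act-linear w A B x y) k) (reflect-linear i A B (act Φ w x) (act Φ w y) k)

  act-zero : ∀ w → act Φ w (λ _ → + 0) ≗ (λ _ → + 0)
  act-zero w = act-linear w (+ 0) (+ 0) (λ _ → + 0) (λ _ → + 0)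

  act-neg : ∀ w x → act Φ w (λ k → - x k) ≗ (λ k → - act Φ w x k)
  act-neg w x k = begin
    act Φ w (λ k → - x k) k
      ≡⟨ act-cong w (λ j → as-combination (x j)) k ⟩
    act Φ w (λ j → -[1+ 0 ] * x j + + 0 * x j) k
      ≡⟨ act-linear w -[1+ 0 ] (+ 0) x x k ⟩
    -[1+ 0 ] * act Φ w x k + + 0 * act Φ w x k
      ≡⟨ as-combination (act Φ w x k) ⟨
    - act Φ w x k ∎
    where
    open ≡-Reasoning
    as-combination : ∀ a → - a ≡ -[1+ 0 ] * a + + 0 * a
    as-combination = solve-∀

  act-++ : ∀ u w x → act Φ (u ++ w) x ≡ act Φ u (act Φ w x)
  act-++ []      w x = refl
  act-++ (i ∷ u) w x = cong (reflect Φ i) (act-++ u w x)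

  act-reverse : ∀ u x → act Φ (reverse u) (act Φ u x) ≗ x
  act-reverse []      x k = refl
  act-reverse (i ∷ u) x k = begin
    act Φ (reverse (i ∷ u)) (act Φ (i ∷ u) x) k
      ≡⟨ cong (λ w → act Φ w (act Φ (i ∷ u) x) k) (ListP.unfold-reverse i u) ⟩
    act Φ (reverse u ∷ʳ i) (reflect Φ i (act Φ u x)) k
      ≡⟨ cong (λ y → y k) (act-++ (reverse u) [ i ] _) ⟩
    act Φ (reverse u) (reflect Φ i (reflect Φ i (act Φ u x))) k
      ≡⟨ act-cong (reverse u) (reflect-involutive i (act Φ u x)) k ⟩
    act Φ (reverse u) (act Φ u x) k
      ≡⟨ act-reverse u x k ⟩
    x k ∎
    where open ≡-Reasoning

  act-α-nonzero : ∀ u v → ¬ (act Φ u (α v) ≗ (λ _ → + 0))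
  act-α-nonzero u v uα≗0 with trans (sym (δ-diag v))
    (trans (sym (act-reverse u (α v) v)) (trans (act-cong (reverse u) uα≗0 v) (act-zero (reverse u) v)))
  ... | ()

  infix 4 _≈_
  -- _∼W_ wrapped in a record, so that both words can be recovered by unification.
  record _≈_ (u w : Word) : Set where
    constructor ≈-intro
    field same-action : _∼W_ Φ u w
  open _≈_

  ≈-refl : ∀ {w} → w ≈ w
  ≈-refl = ≈-intro λ x k → refl

  ≈-reflexive : ∀ {u w} → u ≡ w → u ≈ w
  ≈-reflexive refl = ≈-refl

  ≈-sym : ∀ {u w} → u ≈ w → w ≈ u
  ≈-sym (≈-intro u∼w) = ≈-intro λ x k → sym (u∼w x k)

  ≈-trans : ∀ {u v w} → u ≈ v → v ≈ w → u ≈ w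
  ≈-trans (≈-intro u∼v) (≈-intro v∼w) = ≈-intro λ x k → trans (u∼v x k) (v∼w x k)

  ≈-setoid : Setoid 0ℓ 0ℓ
  ≈-setoid = record
    { Carrier       = Word
    ; _≈_           = _≈_
    ; isEquivalence = record { refl = ≈-refl ; sym = ≈-sym ; trans = ≈-trans }
    }

  module ≈-Reasoning = SetoidReasoning ≈-setoid

  ≈-++ˡ : ∀ c {u w} → u ≈ w → c ++ u ≈ c ++ w
  ≈-++ˡ c {u} {w} (≈-intro u∼w) = ≈-intro λ x k → begin
    act Φ (c ++ u) x k       ≡⟨ cong (λ y → y k) (act-++ c u x) ⟩
    act Φ c (act Φ u x) k    ≡⟨ act-cong c (u∼w x) k ⟩
    act Φ c (act Φ w x) k    ≡⟨ cong (λ y → y k) (act-++ c w x) ⟨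
    act Φ (c ++ w) x k       ∎
    where open ≡-Reasoning

  ≈-++ʳ : ∀ d {u w} → u ≈ w → u ++ d ≈ w ++ d
  ≈-++ʳ d {u} {w} (≈-intro u∼w) = ≈-intro λ x k → begin
    act Φ (u ++ d) x k       ≡⟨ cong (λ y → y k) (act-++ u d x) ⟩
    act Φ u (act Φ d x) k    ≡⟨ u∼w (act Φ d x) k ⟩
    act Φ w (act Φ d x) k    ≡⟨ cong (λ y → y k) (act-++ w d x) ⟨
    act Φ (w ++ d) x k       ∎
    where open ≡-Reasoning

  ≈-reverse : ∀ {u w} → u ≈ w → reverse u ≈ reverse w
  ≈-reverse {u} {w} (≈-intro u∼w) = ≈-intro λ x k → begin
    act Φ (reverse u) x k
      ≡⟨ act-cong (reverse u) (λ j → sym (act-reverse (reverse w) x j)) k ⟩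
    act Φ (reverse u) (act Φ (reverse (reverse w)) (act Φ (reverse w) x)) k
      ≡⟨ cong (λ v → act Φ (reverse u) (act Φ v (act Φ (reverse w) x)) k) (ListP.reverse-involutive w) ⟩
    act Φ (reverse u) (act Φ w (act Φ (reverse w) x)) k
      ≡⟨ act-cong (reverse u) (λ j → sym (u∼w (act Φ (reverse w) x) j)) k ⟩
    act Φ (reverse u) (act Φ u (act Φ (reverse w) x)) k
      ≡⟨ act-reverse u (act Φ (reverse w) x) k ⟩
    act Φ (reverse w) x k ∎
    where open ≡-Reasoning

  ∷-∷-cancel : ∀ s w → s ∷ s ∷ w ≈ w
  ∷-∷-cancel s w = ≈-intro λ x → reflect-involutive s (act Φ w x)

  ∷ʳ-∷ʳ-cancel : ∀ w s → w ∷ʳ s ∷ʳ s ≈ w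
  ∷ʳ-∷ʳ-cancel w s = begin
    w ∷ʳ s ∷ʳ s         ≡⟨ ListP.++-assoc w [ s ] [ s ] ⟩
    w ++ s ∷ s ∷ []     ≈⟨ ≈-++ˡ w (∷-∷-cancel s []) ⟩
    w ++ []             ≡⟨ ListP.++-identityʳ w ⟩
    w                   ∎
    where open ≈-Reasoning

  IsReduced : Word → Set
  IsReduced w = ∀ w′ → w ≈ w′ → length w ℕ.≤ length w′

  Ascent : Word → Fin r → Set
  Ascent w s = ∀ u → w ∷ʳ s ≈ u → length w ℕ.≤ length u

  Shortest : Word → Word → Set
  Shortest w u = w ≈ u × ∀ u′ → w ≈ u′ → length u ℕ.≤ length u′

  ¬¬-shortest : ∀ w → ¬ ¬ Σ Word (Shortest w)
  ¬¬-shortest w noShortest = ¬¬-minimum (length ∘ proj₁) (w , ≈-refl {w})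
    λ { ((u , w≈u) , minimal) → noShortest (u , w≈u , λ u′ w≈u′ → minimal (u′ , w≈u′)) }

  shortest⇒reduced : ∀ {w u} → Shortest w u → IsReduced u
  shortest⇒reduced (w≈u , minimal) u′ u≈u′ = minimal u′ (≈-trans w≈u u≈u′)

  reduced-∷ʳ⇒reduced : ∀ w s → IsReduced (w ∷ʳ s) → IsReduced w
  reduced-∷ʳ⇒reduced w s reduced w′ w≈w′ = ℕ.s≤s⁻¹
    (subst₂ ℕ._≤_ (length-∷ʳ w s) (length-∷ʳ w′ s) (reduced (w′ ∷ʳ s) (≈-++ʳ [ s ] w≈w′)))

  reduced-∷ʳ⇒ascent : ∀ w s → IsReduced (w ∷ʳ s) → Ascent w s
  reduced-∷ʳ⇒ascent w s reduced u ws≈u =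
    ℕP.<⇒≤ (subst (ℕ._≤ length u) (length-∷ʳ w s) (reduced u ws≈u))

  ¬ascent-∷ʳ : ∀ w s → ¬ Ascent (w ∷ʳ s) s
  ¬ascent-∷ʳ w s ascent =
    ℕP.<-irrefl refl (subst (ℕ._≤ length w) (length-∷ʳ w s) (ascent w (∷ʳ-∷ʳ-cancel w s)))

  reduced-reverse : ∀ w → IsReduced w → IsReduced (reverse w)
  reduced-reverse w reduced w′ rw≈w′ =
    subst₂ ℕ._≤_ (sym (ListP.length-reverse w)) (ListP.length-reverse w′) (reduced (reverse w′)
      (≈-trans (≈-reflexive (sym (ListP.reverse-involutive w))) (≈-reverse rw≈w′)))

  reduced⇔reduced-reverse : ∀ w → IsReduced w ⇔ IsReduced (reverse w)
  reduced⇔reduced-reverse w = mk⇔ (reduced-reverse w)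
    (subst IsReduced (ListP.reverse-involutive w) ∘ reduced-reverse (reverse w))

  Reduced⇔IsReduced : ∀ w → Reduced Φ w ⇔ IsReduced w
  Reduced⇔IsReduced w = mk⇔ (λ reduced w′ w≈w′ → reduced w′ (same-action w≈w′))
                            (λ reduced w′ w∼w′ → reduced w′ (≈-intro w∼w′))

  defect : (Fin r → Bool) → Config Φ → Fin r → ℤ
  defect I c v = indicator Φ (I v) - pairCo Φ c v

  private
    -- neighbourSum tests u ≟ v through a helper local to Defs; unification names it here.
    diagonalTest : ∀ I c v → Σ (Fin r → Bool) λ B →
      neighbourSum Φ I c v ≡ sumFin (λ u → if B u then + 0 else nvu Φ v u * c u) + indicator Φ (I v)
    diagonalTest I c v = _ , refl

    masked-summand : ∀ I c v u → (if proj₁ (diagonalTest I c v) u then + 0 else nvu Φ v u * c u)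
                                 ≡ - (c u * cartan u v) + δ v u * (+ 2 * c v)
    masked-summand I c v u with u ≟ v
    ... | yes refl =
      sym (trans (cong₂ (λ a d → - (c u * a) + d * (+ 2 * c u)) (cartan-diag u) (δ-diag u)) (cancel (c u)))
      where
      cancel : ∀ x → - (x * + 2) + + 1 * (+ 2 * x) ≡ + 0
      cancel = solve-∀
    ... | no u≢v = sym (trans (cong (λ d → - (c u * cartan u v) + d * (+ 2 * c v)) (δ-offdiag v u u≢v))
                              (commute (cartan u v) (c u)))
      where
      commute : ∀ a x → - (x * a) + + 0 ≡ - a * x
      commute = solve-∀

  neighbourSum-formula : ∀ I c v → neighbourSum Φ I c v ≡ + 2 * c v + defect I c v
  neighbourSum-formula I c v = begin
    neighbourSum Φ I c v
      ≡⟨ proj₂ (diagonalTest I c v) ⟩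
    sumFin (λ u → if proj₁ (diagonalTest I c v) u then + 0 else nvu Φ v u * c u) + ind
      ≡⟨ cong (_+ ind) (sumFin-cong (masked-summand I c v)) ⟩
    sumFin (λ u → - (c u * cartan u v) + δ v u * (+ 2 * c v)) + ind
      ≡⟨ cong (_+ ind) (sumFin-+ (λ u → - (c u * cartan u v)) (λ u → δ v u * (+ 2 * c v))) ⟩
    sumFin (λ u → - (c u * cartan u v)) + sumFin (λ u → δ v u * (+ 2 * c v)) + ind
      ≡⟨ cong₂ (λ p q → p + q + ind) (sym (neg-distrib-sumFin (λ u → c u * cartan u v)))
                                     (sumFin-δ v (λ _ → + 2 * c v)) ⟩
    - pairCo Φ c v + + 2 * c v + ind
      ≡⟨ rearrange (pairCo Φ c v) (c v) ind ⟩
    + 2 * c v + defect I c v ∎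
    where
    open ≡-Reasoning
    ind : ℤ
    ind = indicator Φ (I v)
    rearrange : ∀ p x i → - p + + 2 * x + i ≡ + 2 * x + (i - p)
    rearrange = solve-∀

  sad⇔defect-pos : ∀ I c v → Sad Φ I c v ⇔ + 0 < defect I c v
  sad⇔defect-pos I c v = mk⇔
    (λ sad → ℤP.≰⇒> λ d≤0 → ℤP.<⇒≱ (subst (+ 2 * c v <_) (neighbourSum-formula I c v) sad)
               (ℤP.≤-trans (ℤP.+-monoʳ-≤ (+ 2 * c v) d≤0) (ℤP.≤-reflexive (ℤP.+-identityʳ _))))
    (λ pos → subst₂ _<_ (ℤP.+-identityʳ _) (sym (neighbourSum-formula I c v))
               (ℤP.+-monoʳ-< (+ 2 * c v) pos))

  move-formula : ∀ I c i → move Φ I c i ≗ (λ u → + 1 * c u + defect I c i * α i u)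
  move-formula I c i u with u ≟ i
  ... | yes refl = trans (cong (_+_ (- c u)) (neighbourSum-formula I c u))
    (trans (cancel (c u) (defect I c u)) (cong (λ d → + 1 * c u + defect I c u * d) (sym (δ-diag u))))
    where
    cancel : ∀ x d → - x + (+ 2 * x + d) ≡ + 1 * x + d * + 1
    cancel = solve-∀
  ... | no u≢i =
    trans (pad (c u) (defect I c i)) (cong (λ d → + 1 * c u + defect I c i * d) (sym (δ-offdiag i u u≢i)))
    where
    pad : ∀ x d → x ≡ + 1 * x + d * + 0
    pad = solve-∀

  pairCo-move : ∀ I c i v → pairCo Φ (move Φ I c i) v ≡ pairCo Φ c v + defect I c i * cartan i v
  pairCo-move I c i v = begin
    pairCo Φ (move Φ I c i) v
      ≡⟨ pairCo-cong (move-formula I c i) v ⟩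
    pairCo Φ (λ u → + 1 * c u + defect I c i * α i u) v
      ≡⟨ pairCo-linear (+ 1) (defect I c i) c (α i) v ⟩
    + 1 * pairCo Φ c v + defect I c i * pairCo Φ (α i) v
      ≡⟨ cong₂ (λ p a → p + defect I c i * a) (ℤP.*-identityˡ (pairCo Φ c v)) (pairCo-α i v) ⟩
    pairCo Φ c v + defect I c i * cartan i v ∎
    where open ≡-Reasoning

  -- potential I c y = 2 (ρ − c, y) for the weight ρ with ⟨ρ, α_v^∨⟩ = [v ∈ I]; a move at i
  -- replaces ρ − c by its mirror image under s_i.
  potential : (Fin r → Bool) → Config Φ → V → ℤ
  potential I c y = sumFin (λ v → y v * (gram v v * defect I c v))

  potential-α : ∀ I c v → potential I c (α v) ≡ gram v v * defect I c v
  potential-α I c v = sumFin-δ v (λ u → gram u u * defect I c u)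

  potential-reflect : ∀ I c i y →
    potential I c (reflect Φ i y) ≡ potential I c y - pairCo Φ y i * (gram i i * defect I c i)
  potential-reflect I c i y = begin
    sumFin (λ v → reflect Φ i y v * weight v)
      ≡⟨ sumFin-cong (λ v → cong (_* weight v) (reflect-combination i y v)) ⟩
    sumFin (λ v → (+ 1 * y v + (- p) * α i v) * weight v)
      ≡⟨ sumFin-cong (λ v → distrib (y v) (α i v) p (weight v)) ⟩
    sumFin (λ v → + 1 * (y v * weight v) + (- p) * (α i v * weight v))
      ≡⟨ sumFin-linear (+ 1) (- p) (λ v → y v * weight v) (λ v → α i v * weight v) ⟩
    + 1 * potential I c y + (- p) * sumFin (λ v → α i v * weight v)
      ≡⟨ cong (λ q → + 1 * potential I c y + (- p) * q) (sumFin-δ i weight) ⟩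
    + 1 * potential I c y + (- p) * weight i
      ≡⟨ simplify (potential I c y) p (weight i) ⟩
    potential I c y - p * weight i ∎
    where
    open ≡-Reasoning
    p : ℤ
    p = pairCo Φ y i
    weight : Fin r → ℤ
    weight v = gram v v * defect I c v
    distrib : ∀ y a p w → (+ 1 * y + (- p) * a) * w ≡ + 1 * (y * w) + (- p) * (a * w)
    distrib = solve-∀
    simplify : ∀ P p w → + 1 * P + (- p) * w ≡ P - p * w
    simplify = solve-∀

  potential-move : ∀ I c i y →
    potential I (move Φ I c i) y ≡ potential I c y - pairCo Φ y i * (gram i i * defect I c i)
  potential-move I c i y = begin
    sumFin (λ v → y v * (gram v v * (indicator Φ (I v) - pairCo Φ (move Φ I c i) v)))
      ≡⟨ sumFin-cong summand ⟩
    sumFin (λ v → + 1 * (y v * (gram v v * defect I c v)) + (- D * gram i i) * (y v * cartan v i))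
      ≡⟨ sumFin-linear (+ 1) (- D * gram i i) (λ v → y v * (gram v v * defect I c v))
                                              (λ v → y v * cartan v i) ⟩
    + 1 * potential I c y + (- D * gram i i) * pairCo Φ y i
      ≡⟨ simplify (potential I c y) D (gram i i) (pairCo Φ y i) ⟩
    potential I c y - pairCo Φ y i * (gram i i * D) ∎
    where
    open ≡-Reasoning
    D : ℤ
    D = defect I c i
    expand : ∀ y g e p D a →
      y * (g * (e - (p + D * a))) ≡ + 1 * (y * (g * (e - p))) + (- D) * (y * (a * g))
    expand = solve-∀
    regroup : ∀ y w D a G → + 1 * (y * w) + (- D) * (y * (a * G)) ≡ + 1 * (y * w) + (- D * G) * (y * a)
    regroup = solve-∀
    simplify : ∀ P D G p → + 1 * P + (- D * G) * p ≡ P - p * (G * D)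
    simplify = solve-∀
    summand : ∀ v → y v * (gram v v * (indicator Φ (I v) - pairCo Φ (move Φ I c i) v))
                    ≡ + 1 * (y v * (gram v v * defect I c v)) + (- D * gram i i) * (y v * cartan v i)
    summand v = begin
      y v * (gram v v * (indicator Φ (I v) - pairCo Φ (move Φ I c i) v))
        ≡⟨ cong (λ p → y v * (gram v v * (indicator Φ (I v) - p))) (pairCo-move I c i v) ⟩
      y v * (gram v v * (indicator Φ (I v) - (pairCo Φ c v + D * cartan i v)))
        ≡⟨ expand (y v) (gram v v) (indicator Φ (I v)) (pairCo Φ c v) D (cartan i v) ⟩
      + 1 * (y v * (gram v v * defect I c v)) + (- D) * (y v * (cartan i v * gram v v))
        ≡⟨ cong (λ t → + 1 * (y v * (gram v v * defect I c v)) + (- D) * (y v * t))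
                (cartan-symmetrised i v) ⟩
      + 1 * (y v * (gram v v * defect I c v)) + (- D) * (y v * (cartan v i * gram i i))
        ≡⟨ regroup (y v) (gram v v * defect I c v) D (cartan v i) (gram i i) ⟩
      + 1 * (y v * (gram v v * defect I c v)) + (- D * gram i i) * (y v * cartan v i) ∎

  potential-move-reflect : ∀ I c i y → potential I (move Φ I c i) y ≡ potential I c (reflect Φ i y)
  potential-move-reflect I c i y = trans (potential-move I c i y) (sym (potential-reflect I c i y))

  after : (Fin r → Bool) → Config Φ → Word → Config Φ
  after I c []      = c
  after I c (i ∷ q) = after I (move Φ I c i) q

  potential-after : ∀ I q c y → potential I (after I c q) y ≡ potential I c (act Φ q y)
  potential-after I []      c y = refl
  potential-after I (i ∷ q) c y =
    trans (potential-after I q (move Φ I c i) y) (potential-move-reflect I c i (act Φ q y))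

  validFrom-++ : ∀ I c p q →
    ValidFrom Φ I c (p ++ q) ⇔ (ValidFrom Φ I c p × ValidFrom Φ I (after I c p) q)
  validFrom-++ I c []      q = mk⇔ (tt ,_) proj₂
  validFrom-++ I c (i ∷ p) q = mk⇔
    (λ { (sad , valid) → let (validp , validq) = to valid in (sad , validp) , validq })
    (λ { ((sad , validp) , validq) → sad , from (validp , validq) })
    where open Equivalence (validFrom-++ I (move Φ I c i) p q)

  validFrom-∷ʳ : ∀ I c q v → ValidFrom Φ I c (q ∷ʳ v) ⇔ (ValidFrom Φ I c q × Sad Φ I (after I c q) v)
  validFrom-∷ʳ I c q v = mk⇔
    (λ valid → let (validq , sad , _) = to valid in validq , sad)
    (λ { (validq , sad) → from (validq , sad , tt) })
    where open Equivalence (validFrom-++ I c q [ v ])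

  sad⇔potential-pos : ∀ I c v → Sad Φ I c v ⇔ + 0 < potential I c (α v)
  sad⇔potential-pos I c v = mk⇔
    (λ sad → subst₂ _<_ (ℤP.*-zeroʳ (gram v v)) (sym (potential-α I c v))
               (ℤP.*-monoˡ-<-pos (gram v v) (Equivalence.to (sad⇔defect-pos I c v) sad)))
    (λ pos → Equivalence.from (sad⇔defect-pos I c v) (ℤP.*-cancelˡ-<-nonNeg (gram v v)
               (subst₂ _<_ (sym (ℤP.*-zeroʳ (gram v v))) (potential-α I c v) pos)))

  allVertices : Fin r → Bool
  allVertices _ = true

  initial : Config Φ
  initial _ = + 0

  height : V → ℤ
  height y = sumFin (λ v → y v * gram v v)

  potential-initial : ∀ y → potential allVertices initial y ≡ height y
  potential-initial y = sumFin-cong λ v →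
    cong (y v *_) (trans (cong (λ p → gram v v * (+ 1 - p)) (sumFin-zero r)) (ℤP.*-identityʳ (gram v v)))

  sad-after⇔height-pos : ∀ q v →
    Sad Φ allVertices (after allVertices initial q) v ⇔ + 0 < height (act Φ q (α v))
  sad-after⇔height-pos q v = subst (Sad Φ allVertices (after allVertices initial q) v ⇔_)
    (cong (+ 0 <_) (trans (potential-after allVertices q initial (α v))
                          (potential-initial (act Φ q (α v)))))
    (sad⇔potential-pos allVertices (after allVertices initial q) v)

  height-nonpos : ∀ y → NonPos y → height y ≤ + 0
  height-nonpos y y≤0 = sumFin-nonpos _ (λ v → ℤP.*-monoʳ-≤-nonNeg (gram v v) (y≤0 v))

  height-pos : ∀ y → NonNeg y → ¬ (y ≗ (λ _ → + 0)) → + 0 < height y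
  height-pos y y≥0 y≢0 = ℤP.≰⇒> λ height≤0 → y≢0 λ k → ℤP.≤-antisym
    (ℤP.≮⇒≥ λ yk>0 → ℤP.<⇒≱ (sumFin-pos _ summand≥0 k (ℤP.*-monoʳ-<-pos (gram k k) yk>0)) height≤0)
    (y≥0 k)
    where
    summand≥0 : ∀ v → + 0 ≤ y v * gram v v
    summand≥0 v = ℤP.*-monoʳ-≤-nonNeg (gram v v) (y≥0 v)

  plane : V → ℤ → Fin r → ℤ → Fin r → V
  plane x P i Q j k = x k + P * α i k + Q * α j k

  plane-swap : ∀ x P i Q j → plane x P i Q j ≗ plane x Q j P i
  plane-swap x P i Q j k = swap (x k) P (α i k) Q (α j k)
    where
    swap : ∀ x P a Q b → x + P * a + Q * b ≡ x + Q * b + P * a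
    swap = solve-∀

  reflect-in-plane : ∀ i j x {y} P Q → y ≗ plane x P i Q j →
    reflect Φ i y ≗ plane x (P - pairCo Φ y i) i Q j
  reflect-in-plane i j x {y} P Q y≗ k = begin
    reflect Φ i y k                                ≡⟨ reflect-formula i y k ⟩
    y k - α i k * pairCo Φ y i                     ≡⟨ cong (_- α i k * pairCo Φ y i) (y≗ k) ⟩
    x k + P * α i k + Q * α j k - α i k * pairCo Φ y i
                                                   ≡⟨ regroup (x k) P (α i k) Q (α j k) (pairCo Φ y i) ⟩
    plane x (P - pairCo Φ y i) i Q j k             ∎
    where
    open ≡-Reasoning
    regroup : ∀ x P a Q b p → x + P * a + Q * b - a * p ≡ x + (P - p) * a + Q * b
    regroup = solve-∀

  pairCo-reflect-self : ∀ i y → pairCo Φ (reflect Φ i y) i ≡ - pairCo Φ y i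
  pairCo-reflect-self i y = trans (pairCo-reflect i y i)
    (trans (cong (λ c → pairCo Φ y i - pairCo Φ y i * c) (cartan-diag i)) (negate (pairCo Φ y i)))
    where
    negate : ∀ p → p - p * + 2 ≡ - p
    negate = solve-∀

  module Dihedral (s t : Fin r) (s≢t : s ≢ t) where
    open Rank2 (cartan s t) (cartan t s)

    letter : Bool → Fin r
    letter true  = s
    letter false = t

    word : List Bool → Word
    word = map letter

    _at_ : Form → V → ℤ
    f at x = ⟦ f ⟧ (pairCo Φ x s) (pairCo Φ x t)

    Tracks : V → PlaneState → V → Set
    Tracks x σ y = (y ≗ plane x (coeffₛ σ at x) s (coeffₜ σ at x) t)
                 × pairCo Φ y s ≡ pairₛ σ at x × pairCo Φ y t ≡ pairₜ σ at x

    tracks-start : ∀ x → Tracks x start x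
    tracks-start x = (λ k → pad (x k) (pairCo Φ x s) (pairCo Φ x t) (α s k) (α t k))
                   , unitₛ (pairCo Φ x s) (pairCo Φ x t) , unitₜ (pairCo Φ x s) (pairCo Φ x t)
      where
      pad : ∀ x p q a b → x ≡ x + (+ 0 * p + + 0 * q) * a + (+ 0 * p + + 0 * q) * b
      pad = solve-∀
      unitₛ : ∀ p q → p ≡ + 1 * p + + 0 * q
      unitₛ = solve-∀
      unitₜ : ∀ p q → q ≡ + 0 * p + + 1 * q
      unitₜ = solve-∀

    tracks-step : ∀ ℓ {x σ y} → Tracks x σ y → Tracks x (step ℓ σ) (reflect Φ (letter ℓ) y)
    tracks-step true {x} {⟨ cₛ , cₜ , pₛ , pₜ ⟩} {y} (y≗ , yₛ , yₜ) =
        (λ k → trans (reflect-in-plane s t x (cₛ at x) (cₜ at x) y≗ k)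
                     (cong (λ c → plane x c s (cₜ at x) t k)
                           (trans (cong (_-_ (cₛ at x)) yₛ) (sym (⟦⟧-sub cₛ pₛ)))))
      , trans (pairCo-reflect-self s y) (trans (cong -_ yₛ) (sym (⟦⟧-neg pₛ)))
      , trans (pairCo-reflect s y t) (trans (cong₂ (λ q p → q - p * cartan s t) yₜ yₛ)
          (sym (trans (⟦⟧-sub pₜ (pₛ *ᶠ cartan s t)) (cong (_-_ (pₜ at x)) (⟦⟧-scale pₛ (cartan s t))))))
    tracks-step false {x} {⟨ cₛ , cₜ , pₛ , pₜ ⟩} {y} (y≗ , yₛ , yₜ) =
        (λ k → trans (reflect-in-plane t s x (cₜ at x) (cₛ at x)
                                       (λ k → trans (y≗ k) (plane-swap x (cₛ at x) s (cₜ at x) t k)) k)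
                     (trans (cong (λ c → plane x c t (cₛ at x) s k)
                                  (trans (cong (_-_ (cₜ at x)) yₜ) (sym (⟦⟧-sub cₜ pₜ))))
                            (plane-swap x ((cₜ -ᶠ pₜ) at x) t (cₛ at x) s k)))
      , trans (pairCo-reflect t y s) (trans (cong₂ (λ p q → p - q * cartan t s) yₛ yₜ)
          (sym (trans (⟦⟧-sub pₛ (pₜ *ᶠ cartan t s)) (cong (_-_ (pₛ at x)) (⟦⟧-scale pₜ (cartan t s))))))
      , trans (pairCo-reflect-self t y) (trans (cong -_ yₜ) (sym (⟦⟧-neg pₜ)))

    tracks-word : ∀ z x → Tracks x (run z) (act Φ (word z) x)
    tracks-word []      x = tracks-start x
    tracks-word (ℓ ∷ z) x = tracks-step ℓ {x} (tracks-word z x)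

    word-≈ : ∀ z z′ → coefficients (run z) ≡ coefficients (run z′) → word z ≈ word z′
    word-≈ z z′ same = ≈-intro λ x k →
      trans (proj₁ (tracks-word z x) k)
        (trans (cong (λ cs → plane x (proj₁ cs at x) s (proj₂ cs at x) t k) same)
               (sym (proj₁ (tracks-word z′ x) k)))

    DihedralReduced DihedralAscent : List Bool → Set
    DihedralReduced z = ∀ z′ → word z ≈ word z′ → length z ℕ.≤ length z′
    DihedralAscent  z = ∀ z′ → word (z ∷ʳ true) ≈ word z′ → length z ℕ.≤ length z′

    dihedralReduced-∷ : ∀ ℓ z → DihedralReduced (ℓ ∷ z) → DihedralReduced z
    dihedralReduced-∷ ℓ z reduced z′ z≈z′ = ℕ.s≤s⁻¹ (reduced (ℓ ∷ z′) (≈-++ˡ [ letter ℓ ] z≈z′))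

    dihedralAscent-∷ : ∀ ℓ z → DihedralAscent (ℓ ∷ z) → DihedralAscent z
    dihedralAscent-∷ ℓ z ascent z′ zs≈z′ = ℕ.s≤s⁻¹ (ascent (ℓ ∷ z′) (≈-++ˡ [ letter ℓ ] zs≈z′))

    reduced-ascent⇒alternating : ∀ z → DihedralReduced z → DihedralAscent z → ∃ λ k → z ≡ alternating k
    reduced-ascent⇒alternating []      _       _      = 0 , refl
    reduced-ascent⇒alternating (ℓ ∷ z) reduced ascent
      with reduced-ascent⇒alternating z (dihedralReduced-∷ ℓ z reduced) (dihedralAscent-∷ ℓ z ascent)
    reduced-ascent⇒alternating (true  ∷ z) reduced ascent | zero , refl
      with () ← ascent [] (∷-∷-cancel s [])
    reduced-ascent⇒alternating (false ∷ z) reduced ascent | zero , refl = 1 , refl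
    reduced-ascent⇒alternating (ℓ ∷ z) reduced ascent | suc k , refl with ℓ ≟ᴮ alternatingHead k
    ... | yes refl = ⊥-elim (ℕP.<-irrefl refl (ℕP.≤-trans (ℕP.n≤1+n _)
            (reduced (alternating k) (∷-∷-cancel (letter ℓ) (word (alternating k))))))
    ... | no ℓ≢head = suc (suc k) , cong (_∷ alternating (suc k)) (¬-not ℓ≢head)

    -- abstract, so that classify is never unfolded at the symbolic Cartan integers.
    abstract
     dihedralData : DihedralData
     dihedralData = classify (cartan s t) (cartan t s)
       (cartan-offdiag-nonpos s t s≢t) (cartan-offdiag-nonpos t s (s≢t ∘ sym))
       (cartan-zero-sym s t) (cartan-zero-sym t s) (cartan-product<4 s t s≢t)
    open DihedralData dihedralData

    word-++ : ∀ P z → word (P ++ z) ≡ word P ++ word z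
    word-++ P z = ListP.map-++ letter P z

    alternating-ascent⇒<order : ∀ k → DihedralAscent (alternating k) → k ℕ.< order
    alternating-ascent⇒<order k ascent with order ℕP.≤? k
    ... | no order≰k = ℕP.≰⇒> order≰k
    ... | yes order≤k with ℕP.m≤n⇒∃[o]m+o≡n order≤k
    ... | j , refl with alternating-split j order
    ... | P , P-length , split =
      ⊥-elim (ℕP.<-irrefl refl (ℕP.≤-<-trans (ascent (P ++ braid-rhs) braided) shorter))
      where
      braided : word (alternating (order ℕ.+ j) ∷ʳ true) ≈ word (P ++ braid-rhs)
      braided = begin
        word (alternating (order ℕ.+ j) ∷ʳ true)
          ≡⟨ cong (λ w → word (w ∷ʳ true)) (trans (cong alternating (ℕP.+-comm order j)) split) ⟩
        word ((P ++ alternating order) ∷ʳ true)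
          ≡⟨ trans (cong word (ListP.++-assoc P (alternating order) [ true ])) (word-++ P _) ⟩
        word P ++ word (alternating order ∷ʳ true)
          ≈⟨ ≈-++ˡ (word P) (word-≈ _ _ braid) ⟩
        word P ++ word braid-rhs
          ≡⟨ word-++ P braid-rhs ⟨
        word (P ++ braid-rhs) ∎
        where open ≈-Reasoning
      shorter : length (P ++ braid-rhs) ℕ.< length (alternating (order ℕ.+ j))
      shorter = subst₂ ℕ._<_
        (sym (trans (ListP.length-++ P) (cong (ℕ._+ length braid-rhs) P-length)))
        (trans (cong (j ℕ.+_) braid-rhs-length) (trans (ℕP.+-comm j order) (sym (length-alternating _))))
        (ℕP.+-monoʳ-< j ℕP.≤-refl)

    dihedral-nonneg : ∀ z → DihedralReduced z → DihedralAscent z →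
      ∃₂ λ A B → + 0 ≤ A × + 0 ≤ B × act Φ (word z) (α s) ≗ (λ k → A * α s k + B * α t k)
    dihedral-nonneg z reduced ascent with reduced-ascent⇒alternating z reduced ascent
    ... | k , refl with alternating-positive (alternating-ascent⇒<order k ascent)
    ... | A≥0 , B≥0 = _ , _ , A≥0 , B≥0 , λ i → begin
      act Φ (word (alternating k)) (α s) i
        ≡⟨ proj₁ (tracks-word (alternating k) (α s)) i ⟩
      plane (α s) (Cₛ at α s) s (Cₜ at α s) t i
        ≡⟨ cong₂ (λ p q → plane (α s) (⟦ Cₛ ⟧ p q) s (⟦ Cₜ ⟧ p q) t i)
                 (trans (pairCo-α s s) (cartan-diag s)) (pairCo-α s t) ⟩
      α s i + ⟦ Cₛ ⟧ (+ 2) (cartan s t) * α s i + ⟦ Cₜ ⟧ (+ 2) (cartan s t) * α t i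
        ≡⟨ collect (α s i) (⟦ Cₛ ⟧ (+ 2) (cartan s t)) (⟦ Cₜ ⟧ (+ 2) (cartan s t)) (α t i) ⟩
      (+ 1 + ⟦ Cₛ ⟧ (+ 2) (cartan s t)) * α s i + ⟦ Cₜ ⟧ (+ 2) (cartan s t) * α t i ∎
      where
      open ≡-Reasoning
      Cₛ Cₜ : Form
      Cₛ = coeffₛ (run (alternating k))
      Cₜ = coeffₜ (run (alternating k))
      collect : ∀ a P Q b → a + P * a + Q * b ≡ (+ 1 + P) * a + Q * b
      collect = solve-∀

    length-word : ∀ v z → length (v ++ word z) ≡ length v ℕ.+ length z
    length-word v z = trans (ListP.length-++ v) (cong (length v ℕ.+_) (ListP.length-map letter z))

    record Factorisation (w : Word) : Set where
      constructor factorisation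
      field
        prefix     : Word
        suffix     : List Bool
        factorises : prefix ++ word suffix ≈ w
        short      : length prefix ℕ.+ length suffix ℕ.≤ length w

    open Factorisation using (prefix)

    Minimal : ∀ {w} → Factorisation w → Set
    Minimal {w} f = ∀ (g : Factorisation w) → length (prefix f) ℕ.≤ length (prefix g)

    module MinimalFactorisation {w} (reduced : IsReduced w) (f : Factorisation w) (minimal : Minimal f)
      where
      open Factorisation f public renaming (prefix to v; suffix to z)

      exact : length v ℕ.+ length z ≡ length w
      exact = ℕP.≤-antisym short (subst (length w ℕ.≤_) (length-word v z) (reduced _ (≈-sym factorises)))

      prefix-reduced : IsReduced v
      prefix-reduced v′ v≈v′ = ℕP.+-cancelʳ-≤ (length z) (length v) (length v′)
        (subst₂ ℕ._≤_ (sym exact) (length-word v′ z)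
          (reduced (v′ ++ word z) (≈-trans (≈-sym factorises) (≈-++ʳ (word z) v≈v′))))

      prefix-ascent : ∀ ℓ → Ascent v (letter ℓ)
      prefix-ascent ℓ u vℓ≈u with length v ℕ.≤? length u
      ... | yes v≤u = v≤u
      ... | no  v≰u = minimal (factorisation u (ℓ ∷ z) factorises′ short′)
        where
        factorises′ : u ++ word (ℓ ∷ z) ≈ w
        factorises′ = begin
          u ++ letter ℓ ∷ word z                  ≡⟨ ListP.++-assoc u [ letter ℓ ] (word z) ⟨
          u ∷ʳ letter ℓ ++ word z                 ≈⟨ ≈-++ʳ (word z) (≈-sym (≈-++ʳ [ letter ℓ ] vℓ≈u)) ⟩
          v ∷ʳ letter ℓ ∷ʳ letter ℓ ++ word z
            ≡⟨ trans (ListP.++-assoc (v ∷ʳ letter ℓ) [ letter ℓ ] (word z))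
                     (ListP.++-assoc v [ letter ℓ ] _) ⟩
          v ++ letter ℓ ∷ letter ℓ ∷ word z       ≈⟨ ≈-++ˡ v (∷-∷-cancel (letter ℓ) (word z)) ⟩
          v ++ word z                             ≈⟨ factorises ⟩
          w                                       ∎
          where open ≈-Reasoning
        short′ : length u ℕ.+ length (ℓ ∷ z) ℕ.≤ length w
        short′ = subst (ℕ._≤ length w) (sym (ℕP.+-suc (length u) (length z)))
          (ℕP.≤-trans (ℕP.+-monoˡ-≤ (length z) (ℕP.≰⇒> v≰u)) (ℕP.≤-reflexive exact))

      suffix-reduced : DihedralReduced z
      suffix-reduced z′ z≈z′ = ℕP.+-cancelˡ-≤ (length v) (length z) (length z′)
        (subst₂ ℕ._≤_ (sym exact) (length-word v z′)
          (reduced (v ++ word z′) (≈-trans (≈-sym factorises) (≈-++ˡ v z≈z′))))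

      suffix-ascent : Ascent w s → DihedralAscent z
      suffix-ascent ascent z′ zs≈z′ = ℕP.+-cancelˡ-≤ (length v) (length z) (length z′)
        (subst₂ ℕ._≤_ (sym exact) (length-word v z′)
          (ascent (v ++ word z′) (begin
            w ∷ʳ s                   ≈⟨ ≈-++ʳ [ s ] (≈-sym factorises) ⟩
            (v ++ word z) ∷ʳ s       ≡⟨ ListP.++-assoc v (word z) [ s ] ⟩
            v ++ word z ∷ʳ s         ≡⟨ cong (v ++_) (word-++ z [ true ]) ⟨
            v ++ word (z ∷ʳ true)    ≈⟨ ≈-++ˡ v zs≈z′ ⟩
            v ++ word z′             ∎)))
        where open ≈-Reasoning

      factorised-nonneg : Ascent w s → NonNeg (act Φ v (α s)) → NonNeg (act Φ v (α t)) →
        NonNeg (act Φ w (α s))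
      factorised-nonneg ascent vαs≥0 vαt≥0 k with dihedral-nonneg z suffix-reduced (suffix-ascent ascent)
      ... | A , B , A≥0 , B≥0 , z-α =
        subst (+ 0 ≤_) (sym expand) (ℤP.+-mono-≤ (*-nonneg A≥0 (vαs≥0 k)) (*-nonneg B≥0 (vαt≥0 k)))
        where
        open ≡-Reasoning
        expand : act Φ w (α s) k ≡ A * act Φ v (α s) k + B * act Φ v (α t) k
        expand = begin
          act Φ w (α s) k                          ≡⟨ same-action factorises (α s) k ⟨
          act Φ (v ++ word z) (α s) k              ≡⟨ cong (λ y → y k) (act-++ v (word z) (α s)) ⟩
          act Φ v (act Φ (word z) (α s)) k         ≡⟨ act-cong v z-α k ⟩
          act Φ v (λ i → A * α s i + B * α t i) k  ≡⟨ act-linear v A B (α s) (α t) k ⟩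
          A * act Φ v (α s) k + B * act Φ v (α t) k ∎

    ascent⇒nonneg-step : ∀ w₀ → IsReduced (w₀ ∷ʳ t) → Ascent (w₀ ∷ʳ t) s →
      (∀ v → length v ℕ.≤ length w₀ → IsReduced v → ∀ i → Ascent v i → NonNeg (act Φ v (α i))) →
      NonNeg (act Φ (w₀ ∷ʳ t) (α s))
    ascent⇒nonneg-step w₀ reduced ascent shorter⇒nonneg = decidable-stable (nonneg? _) λ ¬nonneg →
      ¬¬-minimum (length ∘ prefix) trivial λ { (f , minimal) → ¬nonneg (nonneg f minimal) }
      where
      trivial : Factorisation (w₀ ∷ʳ t)
      trivial = factorisation w₀ (false ∷ []) ≈-refl (ℕP.≤-reflexive (sym (ListP.length-++ w₀)))
      nonneg : (f : Factorisation (w₀ ∷ʳ t)) → Minimal f → NonNeg (act Φ (w₀ ∷ʳ t) (α s))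
      nonneg f minimal = factorised-nonneg ascent (prefix-nonneg true) (prefix-nonneg false)
        where
        open MinimalFactorisation reduced f minimal
        prefix-nonneg : ∀ ℓ → NonNeg (act Φ v (α (letter ℓ)))
        prefix-nonneg ℓ = shorter⇒nonneg v (minimal trivial) prefix-reduced (letter ℓ) (prefix-ascent ℓ)

  ascent⇒nonneg : ∀ w → IsReduced w → ∀ s → Ascent w s → NonNeg (act Φ w (α s))
  ascent⇒nonneg w = go w (On.wellFounded length ℕI.<-wellFounded w)
    where
    go : ∀ w → Acc (ℕ._<_ on length) w → IsReduced w → ∀ s → Ascent w s → NonNeg (act Φ w (α s))
    go w (acc shorter) reduced s ascent with initLast w
    ... | []       = δ-nonneg s
    ... | w₀ ∷ʳ′ t with s ≟ t
    ...   | yes refl = ⊥-elim (¬ascent-∷ʳ w₀ s ascent)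
    ...   | no s≢t   = Dihedral.ascent⇒nonneg-step s t s≢t w₀ reduced ascent λ v v≤w₀ →
                         go v (shorter (subst (length v ℕ.<_) (sym (length-∷ʳ w₀ t)) (s≤s v≤w₀)))

  descent⇒nonpos : ∀ q v w′ → IsReduced q → q ∷ʳ v ≈ w′ → length w′ ℕ.≤ length q → NonPos (act Φ q (α v))
  descent⇒nonpos q v w′ reduced qv≈w′ w′≤q = decidable-stable (nonpos? _) λ ¬nonpos →
    ¬¬-shortest (q ∷ʳ v) λ { (u , shortest) → ¬nonpos (nonpos u shortest) }
    where
    nonpos : ∀ u → Shortest (q ∷ʳ v) u → NonPos (act Φ q (α v))
    nonpos u (qv≈u , minimal) k = subst (_≤ + 0) (sym flip) (ℤP.neg-mono-≤ (uα≥0 k))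
      where
      uv≈q : u ∷ʳ v ≈ q
      uv≈q = ≈-trans (≈-++ʳ [ v ] (≈-sym qv≈u)) (∷ʳ-∷ʳ-cancel q v)
      uα≥0 : NonNeg (act Φ u (α v))
      uα≥0 = ascent⇒nonneg u (shortest⇒reduced (qv≈u , minimal)) v λ u′ uv≈u′ →
        ℕP.≤-trans (minimal w′ qv≈w′) (ℕP.≤-trans w′≤q (reduced u′ (≈-trans (≈-sym uv≈q) uv≈u′)))
      flip : act Φ q (α v) k ≡ - act Φ u (α v) k
      flip = begin
        act Φ q (α v) k                       ≡⟨ same-action uv≈q (α v) k ⟨
        act Φ (u ∷ʳ v) (α v) k                ≡⟨ cong (λ y → y k) (act-++ u [ v ] (α v)) ⟩
        act Φ u (reflect Φ v (α v)) k         ≡⟨ act-cong u (reflect-α-self v) k ⟩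
        act Φ u (λ i → - α v i) k             ≡⟨ act-neg u (α v) k ⟩
        - act Φ u (α v) k                     ∎
        where open ≡-Reasoning

  reduced-∷ʳ⇔height-pos : ∀ q v → IsReduced q → IsReduced (q ∷ʳ v) ⇔ + 0 < height (act Φ q (α v))
  reduced-∷ʳ⇔height-pos q v reduced = mk⇔
    (λ qv-reduced →
      height-pos _ (ascent⇒nonneg q reduced v (reduced-∷ʳ⇒ascent q v qv-reduced)) (act-α-nonzero q v))
    (λ pos w′ qv≈w′ → ℕP.≮⇒≥ λ w′<qv → ℤP.<⇒≱ pos (height-nonpos _ (descent⇒nonpos q v w′ reduced qv≈w′
       (ℕ.s≤s⁻¹ (subst (length w′ ℕ.<_) (length-∷ʳ q v) w′<qv)))))

  validPlay⇔reduced : ∀ p → ValidPlay Φ allVertices p ⇔ IsReduced p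
  validPlay⇔reduced p =
    subst (λ p → ValidPlay Φ allVertices p ⇔ IsReduced p) (ListP.reverse-involutive p)
      (reversed (reverse p))
    where
    reversed : ∀ u → ValidPlay Φ allVertices (reverse u) ⇔ IsReduced (reverse u)
    reversed []      = mk⇔ (λ _ _ _ → z≤n) (λ _ → tt)
    reversed (v ∷ u) rewrite ListP.unfold-reverse v u = mk⇔
      (λ valid → let (valid-q , sad) = to (validFrom-∷ʳ allVertices initial q v) valid in
        from (reduced-∷ʳ⇔height-pos q v (to (reversed u) valid-q)) (to (sad-after⇔height-pos q v) sad))
      (λ reduced → let reduced-q = reduced-∷ʳ⇒reduced q v reduced in
        from (validFrom-∷ʳ allVertices initial q v) (from (reversed u) reduced-q ,
          from (sad-after⇔height-pos q v) (to (reduced-∷ʳ⇔height-pos q v reduced-q) reduced)))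
      where
      open Equivalence
      q : Word
      q = reverse u

mainTheorem4 : {r : ℕ} (Φ : RootSystem r) (p : List (Fin r)) →
    ValidPlay Φ (λ _ → true) p ⇔ Reduced Φ (reverse p)
mainTheorem4 Φ p =
  ⇔.trans (validPlay⇔reduced Φ p)
    (⇔.trans (reduced⇔reduced-reverse Φ p) (⇔.sym (Reduced⇔IsReduced Φ (reverse p))))
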